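{- Let $G$ be a finite group having an element of order $n=\prod_{i=1}^m p_i^{k_i}$, where the $p_i$ are distinct primes and $k_i\ge1$. Then $\Gamma_{sc}(G)$ has a clique of size $\prod_{i=1}^m (k_i+1)-1$.
   Context: For a group $G$, the SCC-graph $\Gamma_{sc}(G)$ is the simple undirected graph whose vertices are the nontrivial conjugacy classes $x^G=\{gxg^{ -1}:g\in G\}$, $x\ne1$, where two distinct vertices $x^G,y^G$ are adjacent if there exist $x'\in x^G$, $y'\in y^G$ with $\langle x',y'\rangle$ solvable. A clique is a set of pairwise adjacent vertices. -}

module Defs where

open import Level using (0ℓ)
open import Data.Nat using (ℕ; zero; suc; _*_; _<_)
open import Data.Fin using (Fin; zero; suc)
open import Data.Product using (Σ; ∃; _×_; _,_)
open import Relation.Binary.PropositionalEquality using (_≡_)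
open import Relation.Nullary using (¬_)
open import Algebra.Core using (Op₁; Op₂)
open import Algebra.Structures using (IsGroup)
open import Function.Bundles using (_↔_)

record FinGroup : Set₁ where
  infixl 7 _∙_
  field
    Carrier : Set
    _∙_     : Op₂ Carrier
    ε       : Carrier
    _⁻¹     : Op₁ Carrier
    isGroup : IsGroup _≡_ _∙_ ε _⁻¹
    size    : ℕ
    enum    : Carrier ↔ Fin size

prodFin : (m : ℕ) → (Fin m → ℕ) → ℕ
prodFin zero    f = 1
prodFin (suc m) f = f zero * prodFin m (λ i → f (suc i))

module _ (G : FinGroup) where
  open FinGroup G

  pow : Carrier → ℕ → Carrier
  pow x zero    = ε
  pow x (suc n) = x ∙ pow x n

  HasOrder : Carrier → ℕ → Set
  HasOrder x n = (0 < n) × (pow x n ≡ ε) × (∀ d → 0 < d → d < n → ¬ (pow x d ≡ ε))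

  InClass : Carrier → Carrier → Set
  InClass x y = ∃ λ g → y ≡ (g ∙ x) ∙ (g ⁻¹)

  data Gen (S : Carrier → Set) : Carrier → Set where
    gen : ∀ {g} → S g → Gen S g
    one : Gen S ε
    mul : ∀ {a b} → Gen S a → Gen S b → Gen S (a ∙ b)
    inv : ∀ {a} → Gen S a → Gen S (a ⁻¹)

  Commutators : (Carrier → Set) → Carrier → Set
  Commutators H g = ∃ λ a → ∃ λ b → H a × H b × (g ≡ ((a ⁻¹ ∙ b ⁻¹) ∙ a) ∙ b)

  Derived : (Carrier → Set) → ℕ → Carrier → Set
  Derived H zero    = H
  Derived H (suc k) = Gen (Commutators (Derived H k))

  Solvable : (Carrier → Set) → Set
  Solvable H = ∃ λ k → ∀ g → Derived H k g → g ≡ ε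

  Pair : Carrier → Carrier → Carrier → Set
  Pair x y g = (g ≡ x) Data.Sum.⊎ (g ≡ y)
    where import Data.Sum

  -- adjacency in Γ_sc(G) between classes x^G and y^G
  SCAdj : Carrier → Carrier → Set
  SCAdj x y = ∃ λ x' → ∃ λ y' → InClass x x' × InClass y y' × Solvable (Gen (Pair x' y'))

  -- a clique of size s in Γ_sc(G), given by representatives c i of
  -- s distinct nontrivial conjugacy classes, pairwise adjacent
  IsSCClique : (s : ℕ) → (Fin s → Carrier) → Set
  IsSCClique s c =
    (∀ i → ¬ (c i ≡ ε)) ×
    (∀ i j → ¬ (i ≡ j) → ¬ InClass (c i) (c j)) ×
    (∀ i j → ¬ (i ≡ j) → SCAdj (c i) (c j))

{-# OPTIONS --safe #-}
module Submission where

-- If x has order n and d ∣ n, then x ^ (n / d) has order d. Elements of different orders are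
-- never conjugate, and any two powers of x commute, so they generate an abelian, hence solvable,
-- subgroup. The divisors d ≠ 1 of n therefore give pairwise adjacent, pairwise non-conjugate,
-- nontrivial classes; by unique factorisation the divisors of ∏ pᵢ ^ kᵢ are the ∏ (kᵢ + 1)
-- distinct numbers ∏ pᵢ ^ eᵢ with eᵢ ≤ kᵢ.

open import Defs
open import Data.Nat using (ℕ; suc; _∸_; _≤_; _^_)
open import Data.Fin using (Fin)
open import Data.Product using (Σ; ∃; _×_)
open import Data.Nat.Primality using (Prime)
open import Function.Definitions using (Injective)
open import Relation.Binary.PropositionalEquality using (_≡_)

open import Level using (0ℓ)
open import Data.Nat using (zero; _+_; _*_; _<_; z≤n; s≤s; _%_; _/_; NonZero; >-nonZero; >-nonZero⁻¹)
open import Data.Nat.Properties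
  using (+-comm; *-comm; *-zeroʳ; *-suc; *-cancelˡ-≡; *-assoc; *-identityˡ; m*n≢0⇒m≢0; m*n≢0⇒n≢0; <⇒≱; ≮⇒≥; n≤0⇒n≡0)
open import Data.Nat.DivMod using (m≡m%n+[m/n]*n; m%n<n)
open import Data.Nat.Divisibility
  using (_∣_; _∤_; divides-refl; ∣-refl; ∣-trans; ∣-antisym; 1∣_; ∣1⇒≡1; ∣⇒≤;
         m∣m*n; *-pres-∣; *-monoʳ-∣; *-cancelˡ-∣; m%n≡0⇒n∣m)
open import Data.Nat.Primality using (euclidsLemma; prime⇒irreducible; prime⇒nonZero; ¬prime[1])
open import Data.Fin using (toℕ; remQuot; combine; punchIn) renaming (zero to fzero; suc to fsuc)
open import Data.Fin.Properties
  using (toℕ-injective; toℕ≤pred[n]; remQuot-combine; combine-remQuot; punchIn-injective; punchInᵢ≢i;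
         0≢1+n; suc-injective)
open import Data.Vec.Functional using (head; tail)
open import Data.Product using (_,_; proj₁; proj₂; uncurry)
open import Data.Sum using (inj₁; inj₂)
open import Data.Empty using (⊥-elim)
open import Function using (_∘_)
open import Relation.Binary.PropositionalEquality using (_≢_; refl; sym; trans; cong; cong₂; subst; module ≡-Reasoning)
open import Algebra.Bundles using (Group)
open import Algebra.Structures using (IsGroup)
import Algebra.Properties.Group as GroupProperties

open _∣_ using (quotient; equality)

module _ (G : FinGroup) where
  open FinGroup G
  open IsGroup isGroup using (assoc; identityˡ; identityʳ; inverseˡ; inverseʳ)

  group : Group 0ℓ 0ℓ
  group = record { isGroup = isGroup }

  open GroupProperties group using (ε⁻¹≈ε; ∙-cancelˡ; x∙y⁻¹≈ε⇒x≈y; ⁻¹-anti-homo-∙)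
  open ≡-Reasoning

  pow-+ : ∀ y a b → pow G y (a + b) ≡ pow G y a ∙ pow G y b
  pow-+ y zero    b = sym (identityˡ _)
  pow-+ y (suc a) b = trans (cong (y ∙_) (pow-+ y a b)) (sym (assoc _ _ _))

  pow-ε : ∀ a → pow G ε a ≡ ε
  pow-ε zero    = refl
  pow-ε (suc a) = trans (identityˡ _) (pow-ε a)

  pow-* : ∀ y a b → pow G (pow G y a) b ≡ pow G y (a * b)
  pow-* y a zero    = cong (pow G y) (sym (*-zeroʳ a))
  pow-* y a (suc b) = begin
    pow G y a ∙ pow G (pow G y a) b ≡⟨ cong (pow G y a ∙_) (pow-* y a b) ⟩
    pow G y a ∙ pow G y (a * b)     ≡⟨ sym (pow-+ y a (a * b)) ⟩
    pow G y (a + a * b)             ≡⟨ cong (pow G y) (sym (*-suc a b)) ⟩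
    pow G y (a * suc b)             ∎

  Commute : Carrier → Carrier → Set
  Commute a b = a ∙ b ≡ b ∙ a

  pow-commute : ∀ y a b → Commute (pow G y a) (pow G y b)
  pow-commute y a b = trans (sym (pow-+ y a b)) (trans (cong (pow G y) (+-comm a b)) (pow-+ y b a))

  ∣⇒pow≡ε : ∀ {y d t} → HasOrder G y d → d ∣ t → pow G y t ≡ ε
  ∣⇒pow≡ε {y} {d} (_ , y^d≡ε , _) (divides-refl q) = begin
    pow G y (q * d)         ≡⟨ cong (pow G y) (*-comm q d) ⟩
    pow G y (d * q)         ≡⟨ sym (pow-* y d q) ⟩
    pow G (pow G y d) q     ≡⟨ cong (λ z → pow G z q) y^d≡ε ⟩
    pow G ε q               ≡⟨ pow-ε q ⟩
    ε                       ∎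

  pow≡ε⇒∣ : ∀ {y d t} → HasOrder G y d → pow G y t ≡ ε → d ∣ t
  pow≡ε⇒∣ {y} {d} {t} y-order@(d>0 , _ , minimal) y^t≡ε = m%n≡0⇒n∣m t d remainder≡0
    where
    instance
      d≢0 : NonZero d
      d≢0 = >-nonZero d>0
    y^remainder≡ε : pow G y (t % d) ≡ ε
    y^remainder≡ε = begin
      pow G y (t % d)                             ≡⟨ sym (identityʳ _) ⟩
      pow G y (t % d) ∙ ε                         ≡⟨ cong (pow G y (t % d) ∙_) (sym (∣⇒pow≡ε y-order (divides-refl (t / d)))) ⟩
      pow G y (t % d) ∙ pow G y ((t / d) * d)     ≡⟨ sym (pow-+ y (t % d) _) ⟩
      pow G y (t % d + (t / d) * d)               ≡⟨ cong (pow G y) (sym (m≡m%n+[m/n]*n t d)) ⟩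
      pow G y t                                   ≡⟨ y^t≡ε ⟩
      ε                                           ∎
    remainder≡0 : t % d ≡ 0
    remainder≡0 = n≤0⇒n≡0 (≮⇒≥ (λ r>0 → minimal (t % d) r>0 (m%n<n t d) y^remainder≡ε))

  hasOrder-unique : ∀ {y a b} → HasOrder G y a → HasOrder G y b → a ≡ b
  hasOrder-unique y-order@(_ , y^a≡ε , _) y-order′@(_ , y^b≡ε , _) =
    ∣-antisym (pow≡ε⇒∣ y-order y^b≡ε) (pow≡ε⇒∣ y-order′ y^a≡ε)

  hasOrder-pow : ∀ {y} q d → HasOrder G y (q * d) → HasOrder G (pow G y q) d
  hasOrder-pow {y} q d y-order@(qd>0 , y^qd≡ε , _) =
    >-nonZero⁻¹ d {{m*n≢0⇒n≢0 q {{qd≢0}}}} , trans (pow-* y q d) y^qd≡ε , minimal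
    where
    qd≢0 : NonZero (q * d)
    qd≢0 = >-nonZero qd>0
    minimal : ∀ t → 0 < t → t < d → pow G (pow G y q) t ≢ ε
    minimal t t>0 t<d y^qt≡ε = <⇒≱ t<d (∣⇒≤ {{>-nonZero t>0}} d∣t)
      where
      d∣t : d ∣ t
      d∣t = *-cancelˡ-∣ q {{m*n≢0⇒m≢0 q {{qd≢0}}}} (pow≡ε⇒∣ y-order (trans (sym (pow-* y q t)) y^qt≡ε))

  hasOrder≢1⇒≢ε : ∀ {y d} → HasOrder G y d → d ≢ 1 → y ≢ ε
  hasOrder≢1⇒≢ε {y} y-order d≢1 y≡ε = d≢1 (∣1⇒≡1 (pow≡ε⇒∣ y-order (trans (identityʳ y) y≡ε)))

  conj : Carrier → Carrier → Carrier
  conj g y = (g ∙ y) ∙ g ⁻¹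

  conj-∙ : ∀ g a b → conj g a ∙ conj g b ≡ conj g (a ∙ b)
  conj-∙ g a b = begin
    ((g ∙ a) ∙ g ⁻¹) ∙ ((g ∙ b) ∙ g ⁻¹) ≡⟨ assoc _ _ _ ⟩
    (g ∙ a) ∙ (g ⁻¹ ∙ ((g ∙ b) ∙ g ⁻¹)) ≡⟨ cong ((g ∙ a) ∙_) (sym (assoc _ _ _)) ⟩
    (g ∙ a) ∙ ((g ⁻¹ ∙ (g ∙ b)) ∙ g ⁻¹) ≡⟨ cong (λ z → (g ∙ a) ∙ (z ∙ g ⁻¹)) (sym (assoc _ _ _)) ⟩
    (g ∙ a) ∙ (((g ⁻¹ ∙ g) ∙ b) ∙ g ⁻¹) ≡⟨ cong (λ z → (g ∙ a) ∙ ((z ∙ b) ∙ g ⁻¹)) (inverseˡ g) ⟩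
    (g ∙ a) ∙ ((ε ∙ b) ∙ g ⁻¹)          ≡⟨ cong (λ z → (g ∙ a) ∙ (z ∙ g ⁻¹)) (identityˡ b) ⟩
    (g ∙ a) ∙ (b ∙ g ⁻¹)                ≡⟨ sym (assoc _ _ _) ⟩
    ((g ∙ a) ∙ b) ∙ g ⁻¹                ≡⟨ cong (_∙ g ⁻¹) (assoc _ _ _) ⟩
    (g ∙ (a ∙ b)) ∙ g ⁻¹                ∎

  conj-ε : ∀ g → conj g ε ≡ ε
  conj-ε g = trans (cong (_∙ g ⁻¹) (identityʳ g)) (inverseʳ g)

  conj≡ε⇒≡ε : ∀ g a → conj g a ≡ ε → a ≡ ε
  conj≡ε⇒≡ε g a ga/g≡ε = ∙-cancelˡ g a ε (trans (x∙y⁻¹≈ε⇒x≈y (g ∙ a) g ga/g≡ε) (sym (identityʳ g)))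

  pow-conj : ∀ g y t → pow G (conj g y) t ≡ conj g (pow G y t)
  pow-conj g y zero    = sym (conj-ε g)
  pow-conj g y (suc t) = trans (cong (conj g y ∙_) (pow-conj g y t)) (conj-∙ g y (pow G y t))

  hasOrder-conj : ∀ {y d} g → HasOrder G y d → HasOrder G (conj g y) d
  hasOrder-conj {y} {d} g (d>0 , y^d≡ε , minimal) =
    d>0 ,
    trans (pow-conj g y d) (trans (cong (conj g) y^d≡ε) (conj-ε g)) ,
    λ t t>0 t<d gy/g^t≡ε → minimal t t>0 t<d (conj≡ε⇒≡ε g _ (trans (sym (pow-conj g y t)) gy/g^t≡ε))

  conjugate-hasOrder-unique : ∀ {y z a b} → InClass G y z → HasOrder G y a → HasOrder G z b → a ≡ b
  conjugate-hasOrder-unique (g , refl) y-order z-order = hasOrder-unique (hasOrder-conj g y-order) z-order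

  inClass-refl : ∀ y → InClass G y y
  inClass-refl y = ε , sym (trans (cong ((ε ∙ y) ∙_) ε⁻¹≈ε) (trans (identityʳ _) (identityˡ y)))

  commute-⁻¹ : ∀ {a b} → Commute a b → Commute a (b ⁻¹)
  commute-⁻¹ {a} {b} ab≡ba = ∙-cancelˡ b (a ∙ b ⁻¹) (b ⁻¹ ∙ a) (begin
    b ∙ (a ∙ b ⁻¹)   ≡⟨ sym (assoc _ _ _) ⟩
    (b ∙ a) ∙ b ⁻¹   ≡⟨ cong (_∙ b ⁻¹) (sym ab≡ba) ⟩
    (a ∙ b) ∙ b ⁻¹   ≡⟨ assoc _ _ _ ⟩
    a ∙ (b ∙ b ⁻¹)   ≡⟨ cong (a ∙_) (inverseʳ b) ⟩
    a ∙ ε            ≡⟨ identityʳ a ⟩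
    a                ≡⟨ sym (identityˡ a) ⟩
    ε ∙ a            ≡⟨ cong (_∙ a) (sym (inverseʳ b)) ⟩
    (b ∙ b ⁻¹) ∙ a   ≡⟨ assoc _ _ _ ⟩
    b ∙ (b ⁻¹ ∙ a)   ∎)

  commute-∙ : ∀ {a b c} → Commute a b → Commute a c → Commute a (b ∙ c)
  commute-∙ {a} {b} {c} ab≡ba ac≡ca = begin
    a ∙ (b ∙ c)  ≡⟨ sym (assoc _ _ _) ⟩
    (a ∙ b) ∙ c  ≡⟨ cong (_∙ c) ab≡ba ⟩
    (b ∙ a) ∙ c  ≡⟨ assoc _ _ _ ⟩
    b ∙ (a ∙ c)  ≡⟨ cong (b ∙_) ac≡ca ⟩
    b ∙ (c ∙ a)  ≡⟨ sym (assoc _ _ _) ⟩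
    (b ∙ c) ∙ a  ∎

  commute-Gen : ∀ {S a g} → (∀ {s} → S s → Commute a s) → Gen G S g → Commute a g
  commute-Gen a-S (Gen.gen s)   = a-S s
  commute-Gen a-S Gen.one       = trans (identityʳ _) (sym (identityˡ _))
  commute-Gen a-S (Gen.mul u v) = commute-∙ (commute-Gen a-S u) (commute-Gen a-S v)
  commute-Gen a-S (Gen.inv u)   = commute-⁻¹ (commute-Gen a-S u)

  Gen-commutative : ∀ {S g h} → (∀ {s t} → S s → S t → Commute s t) → Gen G S g → Gen G S h → Commute g h
  Gen-commutative S-comm g∈ h∈ = commute-Gen (λ s∈ → sym (commute-Gen (S-comm s∈) g∈)) h∈

  commutator≡ε : ∀ {a b} → Commute a b → ((a ⁻¹ ∙ b ⁻¹) ∙ a) ∙ b ≡ ε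
  commutator≡ε {a} {b} ab≡ba = begin
    ((a ⁻¹ ∙ b ⁻¹) ∙ a) ∙ b  ≡⟨ assoc _ _ _ ⟩
    (a ⁻¹ ∙ b ⁻¹) ∙ (a ∙ b)  ≡⟨ cong₂ _∙_ (sym (⁻¹-anti-homo-∙ b a)) ab≡ba ⟩
    (b ∙ a) ⁻¹ ∙ (b ∙ a)     ≡⟨ inverseˡ _ ⟩
    ε                        ∎

  Gen-trivial : ∀ {S g} → (∀ {s} → S s → s ≡ ε) → Gen G S g → g ≡ ε
  Gen-trivial S-triv (Gen.gen s)   = S-triv s
  Gen-trivial S-triv Gen.one       = refl
  Gen-trivial S-triv (Gen.mul u v) = trans (cong₂ _∙_ (Gen-trivial S-triv u) (Gen-trivial S-triv v)) (identityˡ ε)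
  Gen-trivial S-triv (Gen.inv u)   = trans (cong _⁻¹ (Gen-trivial S-triv u)) ε⁻¹≈ε

  commutative⇒solvable : ∀ {S} → (∀ {s t} → S s → S t → Commute s t) → Solvable G (Gen G S)
  commutative⇒solvable S-comm =
    1 , λ _ → Gen-trivial λ { (_ , _ , a∈ , b∈ , refl) → commutator≡ε (Gen-commutative S-comm a∈ b∈) }

  commute⇒SCAdj : ∀ {a b} → Commute a b → SCAdj G a b
  commute⇒SCAdj {a} {b} ab≡ba = a , b , inClass-refl a , inClass-refl b , commutative⇒solvable pair-commute
    where
    pair-commute : ∀ {s t} → Pair G a b s → Pair G a b t → Commute s t
    pair-commute (inj₁ refl) (inj₁ refl) = refl
    pair-commute (inj₁ refl) (inj₂ refl) = ab≡ba
    pair-commute (inj₂ refl) (inj₁ refl) = sym ab≡ba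
    pair-commute (inj₂ refl) (inj₂ refl) = refl

  distinctOrders⇒clique : ∀ {s} (c : Fin s → Carrier) (o : Fin s → ℕ)
    → (∀ i → HasOrder G (c i) (o i)) → (∀ i → o i ≢ 1) → Injective _≡_ _≡_ o
    → (∀ i j → Commute (c i) (c j)) → IsSCClique G s c
  distinctOrders⇒clique c o c-order o≢1 o-injective c-commute =
    (λ i → hasOrder≢1⇒≢ε (c-order i) (o≢1 i)) ,
    (λ i j i≢j i~j → i≢j (o-injective (conjugate-hasOrder-unique i~j (c-order i) (c-order j)))) ,
    (λ i j _ → commute⇒SCAdj (c-commute i j))

^-monoʳ-∣ : ∀ p {a b} → a ≤ b → p ^ a ∣ p ^ b
^-monoʳ-∣ p {b = b} z≤n     = 1∣ (p ^ b)
^-monoʳ-∣ p         (s≤s h) = *-monoʳ-∣ p (^-monoʳ-∣ p h)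

prime∣prime^⇒≡ : ∀ {q r} e → Prime q → Prime r → q ∣ r ^ e → q ≡ r
prime∣prime^⇒≡ zero q-prime _ q∣1 = ⊥-elim (¬prime[1] (subst Prime (∣1⇒≡1 q∣1) q-prime))
prime∣prime^⇒≡ {r = r} (suc e) q-prime r-prime q∣r^1+e with euclidsLemma r (r ^ e) q-prime q∣r^1+e
... | inj₂ q∣r^e = prime∣prime^⇒≡ e q-prime r-prime q∣r^e
... | inj₁ q∣r with prime⇒irreducible r-prime q∣r
...   | inj₁ q≡1 = ⊥-elim (¬prime[1] (subst Prime q≡1 q-prime))
...   | inj₂ q≡r = q≡r

prime∤prodFin : ∀ m (p k : Fin m → ℕ) {q} → Prime q → (∀ i → Prime (p i)) → (∀ i → q ≢ p i)
  → q ∤ prodFin m (λ i → p i ^ k i)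
prime∤prodFin zero    p k q-prime _ _ q∣1 = ¬prime[1] (subst Prime (∣1⇒≡1 q∣1) q-prime)
prime∤prodFin (suc m) p k q-prime p-prime q≢p q∣prod
  with euclidsLemma (head p ^ head k) (prodFin m (λ i → tail p i ^ tail k i)) q-prime q∣prod
... | inj₁ q∣p₀^k₀ = q≢p fzero (prime∣prime^⇒≡ (head k) q-prime (p-prime fzero) q∣p₀^k₀)
... | inj₂ q∣rest = prime∤prodFin m (tail p) (tail k) q-prime (p-prime ∘ fsuc) (q≢p ∘ fsuc) q∣rest

p^a*m≡p^b*n⇒a≡b×m≡n : ∀ p .{{_ : NonZero p}} a b {m n} → p ∤ m → p ∤ n → p ^ a * m ≡ p ^ b * n → a ≡ b × m ≡ n
p^a*m≡p^b*n⇒a≡b×m≡n p zero zero {m} {n} _ _ eq = refl , trans (sym (*-identityˡ m)) (trans eq (*-identityˡ n))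
p^a*m≡p^b*n⇒a≡b×m≡n p zero (suc b) {m} {n} p∤m _ eq =
  ⊥-elim (p∤m (subst (p ∣_) (sym (trans (sym (*-identityˡ m)) (trans eq (*-assoc p (p ^ b) n)))) (m∣m*n _)))
p^a*m≡p^b*n⇒a≡b×m≡n p (suc a) zero {m} {n} _ p∤n eq =
  ⊥-elim (p∤n (subst (p ∣_) (sym (trans (sym (*-identityˡ n)) (trans (sym eq) (*-assoc p (p ^ a) m)))) (m∣m*n _)))
p^a*m≡p^b*n⇒a≡b×m≡n p (suc a) (suc b) {m} {n} p∤m p∤n eq
  with p^a*m≡p^b*n⇒a≡b×m≡n p a b p∤m p∤n
         (*-cancelˡ-≡ _ _ p (trans (sym (*-assoc p (p ^ a) m)) (trans eq (*-assoc p (p ^ b) n))))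
... | refl , m≡n = refl , m≡n

-- An index in Fin (∏ (kᵢ + 1)) is read in mixed radix, via remQuot, as exponents eᵢ ≤ kᵢ;
-- the divisor it names is ∏ pᵢ ^ eᵢ.
divisor : ∀ m (p k : Fin m → ℕ) → Fin (prodFin m (suc ∘ k)) → ℕ
divisor zero    p k _ = 1
divisor (suc m) p k i =
  let (e , i′) = remQuot {suc (head k)} (prodFin m (suc ∘ tail k)) i
  in head p ^ toℕ e * divisor m (tail p) (tail k) i′

unitIndex : ∀ m (k : Fin m → ℕ) → Fin (prodFin m (suc ∘ k))
unitIndex zero    k = fzero
unitIndex (suc m) k = combine {suc (head k)} fzero (unitIndex m (tail k))

divisor-unitIndex : ∀ m (p k : Fin m → ℕ) → divisor m p k (unitIndex m k) ≡ 1
divisor-unitIndex zero    p k = refl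
divisor-unitIndex (suc m) p k = begin
  divisor (suc m) p k (unitIndex (suc m) k)
    ≡⟨ cong (λ (e , i′) → head p ^ toℕ e * divisor m (tail p) (tail k) i′)
            (remQuot-combine {suc (head k)} {prodFin m (suc ∘ tail k)} fzero (unitIndex m (tail k))) ⟩
  1 * divisor m (tail p) (tail k) (unitIndex m (tail k))
    ≡⟨ *-identityˡ _ ⟩
  divisor m (tail p) (tail k) (unitIndex m (tail k))
    ≡⟨ divisor-unitIndex m (tail p) (tail k) ⟩
  1 ∎
  where open ≡-Reasoning

divisor-∣ : ∀ m (p k : Fin m → ℕ) i → divisor m p k i ∣ prodFin m (λ j → p j ^ k j)
divisor-∣ zero    p k i = ∣-refl
divisor-∣ (suc m) p k i =
  *-pres-∣ (^-monoʳ-∣ (head p) (toℕ≤pred[n] (proj₁ (remQuot {suc (head k)} (prodFin m (suc ∘ tail k)) i))))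
           (divisor-∣ m (tail p) (tail k) _)

remQuot-injective : ∀ {n} k {i j : Fin (n * k)} → remQuot {n} k i ≡ remQuot k j → i ≡ j
remQuot-injective {n} k {i} {j} eq =
  trans (sym (combine-remQuot {n} k i)) (trans (cong (uncurry combine) eq) (combine-remQuot {n} k j))

prime∤divisor : ∀ m (p k : Fin m → ℕ) {q} → Prime q → (∀ i → Prime (p i)) → (∀ i → q ≢ p i)
  → ∀ i → q ∤ divisor m p k i
prime∤divisor m p k q-prime p-prime q≢p i q∣d =
  prime∤prodFin m p k q-prime p-prime q≢p (∣-trans q∣d (divisor-∣ m p k i))

divisor-injective : ∀ m (p k : Fin m → ℕ) → (∀ i → Prime (p i)) → Injective _≡_ _≡_ p
  → Injective _≡_ _≡_ (divisor m p k)
divisor-injective zero    p k _ _ {fzero} {fzero} _ = refl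
divisor-injective (suc m) p k p-prime p-injective {i} {j} eq
  with p^a*m≡p^b*n⇒a≡b×m≡n (head p) {{prime⇒nonZero (p-prime fzero)}} _ _ (p₀∤divisor _) (p₀∤divisor _) eq
  where
  p₀∤divisor : ∀ i′ → head p ∤ divisor m (tail p) (tail k) i′
  p₀∤divisor = prime∤divisor m (tail p) (tail k) (p-prime fzero) (p-prime ∘ fsuc)
                             (λ j p₀≡pⱼ → 0≢1+n (p-injective p₀≡pⱼ))
... | e≡e′ , d≡d′ =
  remQuot-injective (prodFin m (suc ∘ tail k))
    (cong₂ _,_ (toℕ-injective e≡e′)
               (divisor-injective m (tail p) (tail k) (p-prime ∘ fsuc) (λ eq′ → suc-injective (p-injective eq′)) d≡d′))

punchIn-embedding : ∀ {N} (z : Fin N)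
  → Σ (Fin (N ∸ 1) → Fin N) λ e → Injective _≡_ _≡_ e × (∀ j → e j ≢ z)
punchIn-embedding {suc _} z = punchIn z , (λ {j} {j′} → punchIn-injective z j j′) , punchInᵢ≢i z

mainTheorem8 : (G : FinGroup) → (x : FinGroup.Carrier G) → (n m : ℕ)
    → (p k : Fin m → ℕ)
    → (∀ i → Prime (p i)) → Injective _≡_ _≡_ p → (∀ i → 1 ≤ k i)
    → n ≡ prodFin m (λ i → p i ^ k i)
    → HasOrder G x n
    → Σ (Fin (prodFin m (λ i → suc (k i)) ∸ 1) → FinGroup.Carrier G)
    (IsSCClique G (prodFin m (λ i → suc (k i)) ∸ 1))
mainTheorem8 G x n m p k p-prime p-injective _ refl x-order =
  c , distinctOrders⇒clique G c (d ∘ e) c-order d∘e≢1 (e-injective ∘ d-injective) c-commute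
  where
  D : ℕ
  D = prodFin m (suc ∘ k)
  d : Fin D → ℕ
  d = divisor m p k
  d-injective : Injective _≡_ _≡_ d
  d-injective = divisor-injective m p k p-prime p-injective
  embedding : Σ (Fin (D ∸ 1) → Fin D) λ e → Injective _≡_ _≡_ e × (∀ j → e j ≢ unitIndex m k)
  embedding = punchIn-embedding (unitIndex m k)
  e : Fin (D ∸ 1) → Fin D
  e = proj₁ embedding
  e-injective : Injective _≡_ _≡_ e
  e-injective = proj₁ (proj₂ embedding)
  e≢unitIndex : ∀ j → e j ≢ unitIndex m k
  e≢unitIndex = proj₂ (proj₂ embedding)
  d∣n : ∀ j → d (e j) ∣ prodFin m (λ i → p i ^ k i)
  d∣n j = divisor-∣ m p k (e j)
  c : Fin (D ∸ 1) → FinGroup.Carrier G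
  c j = pow G x (quotient (d∣n j))
  c-order : ∀ j → HasOrder G (c j) (d (e j))
  c-order j = hasOrder-pow G (quotient (d∣n j)) (d (e j)) (subst (HasOrder G x) (equality (d∣n j)) x-order)
  d∘e≢1 : ∀ j → d (e j) ≢ 1
  d∘e≢1 j d≡1 = e≢unitIndex j (d-injective (trans d≡1 (sym (divisor-unitIndex m p k))))
  c-commute : ∀ i j → Commute G (c i) (c j)
  c-commute i j = pow-commute G x (quotient (d∣n i)) (quotient (d∣n j))
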